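{- Let $G$ be a 2d-Rubik's shape with exactly two distinguished cycles $C_1, C_2$, and suppose both $C_1$ and $C_2$ have an odd number of edges. Then $G$ is not a complete 2d-Rubik's shape.
   Context: A 2d-Rubik's shape is a graph $G$ together with a set of distinct cycles $\{C_1,\dots,C_n\}$ of $G$, defined inductively: (1) for $m\ge 3$, an $m$-cycle (with itself as the unique distinguished cycle) is a 2d-Rubik's shape; (2) if $G$ with distinguished cycles $\{C_1,\dots,C_n\}$ is a 2d-Rubik's shape and $P$ is a path in $G$ with at least two vertices such that $E(P)\cap E(C_i)\cap E(C_j)=\emptyset$ for all distinct $i,j$, and $G'$ is obtained by adding new vertices $v_1,\dots,v_k$ with $v_i$ adjacent to $v_{i+1}$ and $v_1,v_k$ joined by edges to the two different endpoints of $P$, then $G'$ with distinguished cycles $\{C_1,\dots,C_n\}\cup\{P\cup\{v_1,\dots,v_k\}\}$ is a 2d-Rubik's shape. For each distinguished cycle $C_i$, let $\sigma_i\in\mathrm{Sym}(E(G))$ be the permutation of the edge set which rotates the edges of $C_i$ cyclically one step and fixes all other edges. The shape is complete if the subgroup of $\mathrm{Sym}(E(G))$ generated by the $\sigma_i$ is (isomorphic to, equivalently equal to) $\mathrm{Sym}(E(G))$. -}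

module Defs where

open import Data.Nat using (ℕ; zero; suc; _+_; _≤_; _%_)
open import Data.Fin using (Fin; zero; suc; _↑ˡ_; _↑ʳ_; _≟_)
open import Data.Fin.Permutation using (Permutation′; _⟨$⟩ʳ_)
open import Data.List using (List; []; _∷_; _++_; map; reverse; length; lookup; allFin)
open import Data.List.Membership.Propositional using (_∈_; _∉_)
open import Data.List.Relation.Unary.Unique.Propositional using (Unique)
open import Data.Maybe using (Maybe; just; nothing)
import Data.Maybe as Maybe
open import Data.Product using (_×_; _,_; proj₁; proj₂; ∃)
open import Data.Sum using (_⊎_)
open import Relation.Binary.PropositionalEquality using (_≡_; _≢_)
open import Relation.Nullary using (yes; no)

-- A distinguished cycle is recorded as the list of its edges in
-- traversal (cyclic) order.

record Shape : Set where
  field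
    nV     : ℕ
    nE     : ℕ
    ends   : Fin nE → Fin nV × Fin nV
    cycles : List (List (Fin nE))
open Shape public

Joins : (S : Shape) → Fin (nE S) → Fin (nV S) → Fin (nV S) → Set
Joins S e a c = ends S e ≡ (a , c) ⊎ ends S e ≡ (c , a)

data Walk (S : Shape) : Fin (nV S) → Fin (nV S) → List (Fin (nE S)) → List (Fin (nV S)) → Set where
  here : ∀ {a} → Walk S a a [] (a ∷ [])
  step : ∀ {a b c e es vs} → Joins S e a c → Walk S c b es vs → Walk S a b (e ∷ es) (a ∷ vs)

record IsPath (S : Shape) (a b : Fin (nV S)) (es : List (Fin (nE S))) : Set where
  field
    verts    : List (Fin (nV S))
    walk     : Walk S a b es verts
    distinct : Unique verts
    nonTriv  : 1 ≤ length es

EdgeCondition : (S : Shape) → List (Fin (nE S)) → Set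
EdgeCondition S es =
  ∀ e → e ∈ es → (i j : Fin (length (cycles S))) → i ≢ j →
    e ∈ lookup (cycles S) i → e ∉ lookup (cycles S) j

lowerLast : ∀ {m} → Fin (suc m) → Maybe (Fin m)
lowerLast {zero}  zero    = nothing
lowerLast {suc m} zero    = just zero
lowerLast {suc m} (suc i) = Maybe.map suc (lowerLast i)

sucMod : ∀ {m} → Fin (suc m) → Fin (suc m)
sucMod i with lowerLast i
... | nothing = zero
... | just j  = suc j

cycleShape : ℕ → Shape
cycleShape m = record
  { nV = m ; nE = m ; ends = endsC m ; cycles = allFin m ∷ [] }
  where
    endsC : (m : ℕ) → Fin m → Fin m × Fin m
    endsC (suc m) i = i , sucMod i

-- (2) adding a path of k = suc k' new vertices v_1..v_k between the
-- endpoints a (joined to v_1) and b (joined to v_k) of the path P (edges es).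
-- New vertices: nV S ↑ʳ t  (t : Fin (suc k') , t = 0 is v_1).
-- New edges:    nE S ↑ʳ j  (j : Fin (suc (suc k'))):
--   j = 0 joins a and v_1; j = t+1 joins v_{t+1} and v_{t+2}, the last one
--   joins v_k and b.
extend : (S : Shape) (a b : Fin (nV S)) (es : List (Fin (nE S))) (k' : ℕ) → Shape
extend S a b es k' = record
  { nV = nV S + suc k'
  ; nE = nE S + suc (suc k')
  ; ends = ends'
  ; cycles = map (map old) (cycles S) ++ (newCycle ∷ [])
  }
  where
    oldV : Fin (nV S) → Fin (nV S + suc k')
    oldV v = v ↑ˡ suc k'
    newV : Fin (suc k') → Fin (nV S + suc k')
    newV t = nV S ↑ʳ t
    old : Fin (nE S) → Fin (nE S + suc (suc k'))
    old f = f ↑ˡ suc (suc k')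
    new : Fin (suc (suc k')) → Fin (nE S + suc (suc k'))
    new j = nE S ↑ʳ j
    leftV : Fin (suc (suc k')) → Fin (nV S + suc k')
    leftV zero    = oldV a
    leftV (suc t) = newV t
    rightV : Fin (suc (suc k')) → Fin (nV S + suc k')
    rightV j with lowerLast j
    ... | nothing = oldV b
    ... | just t  = newV t
    ends' : Fin (nE S + suc (suc k')) → Fin (nV S + suc k') × Fin (nV S + suc k')
    ends' e with Data.Fin.splitAt (nE S) e
    ... | Data.Sum.inj₁ f = oldV (proj₁ (ends S f)) , oldV (proj₂ (ends S f))
    ... | Data.Sum.inj₂ j = leftV j , rightV j
    -- traverse P from a to b, then the new edges back from b to a
    newCycle : List (Fin (nE S + suc (suc k')))
    newCycle = map old es ++ reverse (map new (allFin (suc (suc k'))))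

data IsRubiksShape : Shape → Set where
  base : ∀ m → 3 ≤ m → IsRubiksShape (cycleShape m)
  add  : ∀ {S} → IsRubiksShape S →
         (a b : Fin (nV S)) (es : List (Fin (nE S))) →
         IsPath S a b es → EdgeCondition S es →
         (k' : ℕ) → IsRubiksShape (extend S a b es k')

-- The rotation of a cycle (given as its edge list in cyclic order):
-- e_i ↦ e_{i+1 mod length}, all other edges fixed.

-- rotGo first x xs e : x is the current edge, xs the remaining ones
rotGo : ∀ {n} → Fin n → Fin n → List (Fin n) → Fin n → Fin n
rotGo first x []       e with e ≟ x
... | yes _ = first
... | no  _ = e
rotGo first x (y ∷ xs) e with e ≟ x
... | yes _ = y
... | no  _ = rotGo first y xs e

rotate : ∀ {n} → List (Fin n) → Fin n → Fin n
rotate []       e = e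
rotate (x ∷ xs) e = rotGo x x xs e

rotateInv : ∀ {n} → List (Fin n) → Fin n → Fin n
rotateInv c = rotate (reverse c)

-- The subgroup of Sym(E) generated by the rotations σ_i
-- (closure of the identity under left multiplication by σ_i and σ_i⁻¹).
data Generated (S : Shape) : (Fin (nE S) → Fin (nE S)) → Set where
  gid  : Generated S (λ e → e)
  gmul : ∀ {f} c → c ∈ cycles S → Generated S f → Generated S (λ e → rotate c (f e))
  ginv : ∀ {f} c → c ∈ cycles S → Generated S f → Generated S (λ e → rotateInv c (f e))

Complete : Shape → Set
Complete S = (π : Permutation′ (nE S)) →
  ∃ λ f → Generated S f × (∀ e → f e ≡ π ⟨$⟩ʳ e)

Odd : ℕ → Set
Odd n = n % 2 ≡ 1

-- The inversion parity of the list f 0, f 1, …, f (n-1) is a sign for maps f on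
-- the edge set. A transposition flips it, so the rotation of a cycle with m
-- distinct edges, a product of m - 1 transpositions, preserves it when m is odd.
-- The distinguished cycles of a 2d-Rubik's shape never repeat an edge, so with
-- two odd cycles every generated map preserves the parity, while the
-- transposition of two edges (there are at least two) does not.
module Submission where

open import Defs
open import Data.Bool using (Bool; true; false; not; _xor_)
open import Data.Bool.Properties
  using (not-involutive; not-distribˡ-xor; not-distribʳ-xor; not-¬; xor-assoc; xor-comm)
open import Data.Empty using (⊥-elim)
open import Data.Fin using (Fin; zero; suc; toℕ; _≟_; _↑ˡ_; _↑ʳ_; splitAt)
open import Data.Fin.Properties using (toℕ-injective; ↑ˡ-injective; ↑ʳ-injective; splitAt-↑ˡ; splitAt-↑ʳ)
open import Data.Fin.Permutation using (transpose)
import Data.Fin.Permutation.Components as PC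
open import Data.List using (List; []; _∷_; _++_; map; length; reverse; allFin)
open import Data.List.Properties using (map-id; map-id-local; map-++; map-cong; map-∘; length-reverse; ++-assoc)
open import Data.List.Membership.Propositional using (_∈_)
open import Data.List.Membership.Propositional.Properties using (∈-map⁺; ∈-map⁻; ∈-++⁻; ∈-allFin)
open import Data.List.Relation.Unary.All as All using (All; []; _∷_)
import Data.List.Relation.Unary.All.Properties as Allₚ
open import Data.List.Relation.Unary.Any using (here; there)
import Data.List.Relation.Unary.Any.Properties as Anyₚ
open import Data.List.Relation.Unary.AllPairs using ([]; _∷_)
open import Data.List.Relation.Unary.Unique.Propositional using (Unique)
import Data.List.Relation.Unary.Unique.Propositional.Properties as Unique
import Data.List.Relation.Binary.Permutation.Setoid as Perm
import Data.List.Relation.Binary.Permutation.Setoid.Properties as Perm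
open import Data.Nat using (ℕ; zero; suc; _+_; _≤_; z≤n; s≤s; _<ᵇ_)
open import Data.Nat.Properties using (≤-trans; m≤n+m)
open import Data.Product using (_×_; _,_; proj₁; proj₂; ∃₂)
open import Data.Sum using (_⊎_; inj₁; inj₂)
open import Function using (_∘_; id)
open import Relation.Binary.PropositionalEquality
  using (_≡_; _≢_; _≗_; refl; sym; trans; cong; cong₂; subst; ≢-sym; setoid; module ≡-Reasoning)
open import Relation.Nullary using (¬_; Dec; yes; no)
open import Relation.Nullary.Decidable using (dec-true; dec-false)

<ᵇ-flip : ∀ {m k} → m ≢ k → (k <ᵇ m) ≡ not (m <ᵇ k)
<ᵇ-flip {zero}  {zero}  m≢k = ⊥-elim (m≢k refl)
<ᵇ-flip {zero}  {suc k} m≢k = refl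
<ᵇ-flip {suc m} {zero}  m≢k = refl
<ᵇ-flip {suc m} {suc k} m≢k = <ᵇ-flip (m≢k ∘ cong suc)

xor-swapˡ : ∀ x y z → x xor (y xor z) ≡ y xor (x xor z)
xor-swapˡ x y z = begin
  x xor (y xor z)  ≡⟨ xor-assoc x y z ⟨
  (x xor y) xor z  ≡⟨ cong (_xor z) (xor-comm x y) ⟩
  (y xor x) xor z  ≡⟨ xor-assoc y x z ⟩
  y xor (x xor z)  ∎
  where open ≡-Reasoning

unique-split : ∀ {A : Set} {l : List A} {y} → Unique l → y ∈ l →
  ∃₂ λ B C → l ≡ B ++ y ∷ C × All (y ≢_) B × All (y ≢_) C
unique-split (y∉l ∷ _) (here refl) = [] , _ , refl , [] , y∉l
unique-split (z∉l ∷ l!) (there y∈l) with unique-split l! y∈l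
... | B , C , refl , y∉B , y∉C = _ ∷ B , C , refl , ≢-sym (All.lookup z∉l y∈l) ∷ y∉B , y∉C

unique-reverse : ∀ {A : Set} {xs : List A} → Unique xs → Unique (reverse xs)
unique-reverse {A} {xs} =
  Perm.Unique-resp-↭ (setoid A) (Perm.↭-sym (setoid A) (Perm.↭-reverse (setoid A) xs))

map-fixing : ∀ {A : Set} {f : A → A} B {u} C → All (λ b → f b ≡ b) B → All (λ b → f b ≡ b) C →
  map f (B ++ u ∷ C) ≡ B ++ f u ∷ C
map-fixing {f = f} B C fixB fixC = begin
  map f (B ++ _ ∷ C)         ≡⟨ map-++ f B _ ⟩
  map f B ++ _ ∷ map f C     ≡⟨ cong₂ (λ B′ C′ → B′ ++ _ ∷ C′) (map-id-local fixB) (map-id-local fixC) ⟩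
  B ++ _ ∷ C                 ∎
  where open ≡-Reasoning

module _ {n : ℕ} where

  belowParity : Fin n → List (Fin n) → Bool
  belowParity a []      = false
  belowParity a (b ∷ l) = (toℕ b <ᵇ toℕ a) xor belowParity a l

  inversionParity : List (Fin n) → Bool
  inversionParity []      = false
  inversionParity (a ∷ l) = belowParity a l xor inversionParity l

  belowParity-swap : ∀ a P (u v : Fin n) Q →
    belowParity a (P ++ u ∷ v ∷ Q) ≡ belowParity a (P ++ v ∷ u ∷ Q)
  belowParity-swap a []      u v Q = xor-swapˡ (toℕ u <ᵇ toℕ a) (toℕ v <ᵇ toℕ a) (belowParity a Q)
  belowParity-swap a (p ∷ P) u v Q = cong ((toℕ p <ᵇ toℕ a) xor_) (belowParity-swap a P u v Q)

  inversionParity-swapAdjacent : ∀ P {a b : Fin n} Q → a ≢ b →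
    inversionParity (P ++ a ∷ b ∷ Q) ≡ not (inversionParity (P ++ b ∷ a ∷ Q))
  inversionParity-swapAdjacent [] {a} {b} Q a≢b = begin
    ((b<a) xor A) xor (B xor R)      ≡⟨ xor-assoc (b<a) A (B xor R) ⟩
    (b<a) xor (A xor (B xor R))      ≡⟨ cong ((b<a) xor_) (xor-swapˡ A B R) ⟩
    (b<a) xor (B xor (A xor R))      ≡⟨ cong (_xor (B xor (A xor R))) (<ᵇ-flip (a≢b ∘ toℕ-injective)) ⟩
    not (a<b) xor (B xor (A xor R))  ≡⟨ not-distribˡ-xor (a<b) (B xor (A xor R)) ⟨
    not ((a<b) xor (B xor (A xor R))) ≡⟨ cong not (xor-assoc (a<b) B (A xor R)) ⟨
    not (((a<b) xor B) xor (A xor R)) ∎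
    where
      open ≡-Reasoning
      a<b = toℕ a <ᵇ toℕ b
      b<a = toℕ b <ᵇ toℕ a
      A = belowParity a Q
      B = belowParity b Q
      R = inversionParity Q
  inversionParity-swapAdjacent (p ∷ P) {a} {b} Q a≢b = begin
    belowParity p (P ++ a ∷ b ∷ Q) xor inversionParity (P ++ a ∷ b ∷ Q)
      ≡⟨ cong₂ _xor_ (belowParity-swap p P a b Q) (inversionParity-swapAdjacent P Q a≢b) ⟩
    belowParity p (P ++ b ∷ a ∷ Q) xor not (inversionParity (P ++ b ∷ a ∷ Q))
      ≡⟨ not-distribʳ-xor (belowParity p (P ++ b ∷ a ∷ Q)) (inversionParity (P ++ b ∷ a ∷ Q)) ⟨
    not (belowParity p (P ++ b ∷ a ∷ Q) xor inversionParity (P ++ b ∷ a ∷ Q)) ∎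
    where open ≡-Reasoning

  -- Exchanging x and y takes 2|B| + 1 adjacent swaps.
  inversionParity-swap : ∀ A {x y : Fin n} B C → x ≢ y → All (x ≢_) B → All (y ≢_) B →
    inversionParity (A ++ x ∷ B ++ y ∷ C) ≡ not (inversionParity (A ++ y ∷ B ++ x ∷ C))
  inversionParity-swap A []      C x≢y []          []          = inversionParity-swapAdjacent A C x≢y
  inversionParity-swap A {x} {y} (b ∷ B) C x≢y (x≢b ∷ x∉B) (y≢b ∷ y∉B) = begin
    par (A ++ x ∷ b ∷ B ++ y ∷ C)
      ≡⟨ inversionParity-swapAdjacent A _ x≢b ⟩
    not (par (A ++ b ∷ x ∷ B ++ y ∷ C))
      ≡⟨ cong (not ∘ par) (++-assoc A _ _) ⟨
    not (par ((A ++ b ∷ []) ++ x ∷ B ++ y ∷ C))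
      ≡⟨ cong not (inversionParity-swap (A ++ b ∷ []) B C x≢y x∉B y∉B) ⟩
    not (not (par ((A ++ b ∷ []) ++ y ∷ B ++ x ∷ C)))
      ≡⟨ not-involutive _ ⟩
    par ((A ++ b ∷ []) ++ y ∷ B ++ x ∷ C)
      ≡⟨ cong par (++-assoc A _ _) ⟩
    par (A ++ b ∷ y ∷ B ++ x ∷ C)
      ≡⟨ inversionParity-swapAdjacent A _ (≢-sym y≢b) ⟩
    not (par (A ++ y ∷ b ∷ B ++ x ∷ C)) ∎
    where
      open ≡-Reasoning
      par = inversionParity

module _ {n : ℕ} where

  transpose-matchˡ : (x y : Fin n) → PC.transpose x y x ≡ y
  transpose-matchˡ x y rewrite dec-true (x ≟ x) refl = refl

  transpose-matchʳ : (x y : Fin n) → PC.transpose x y y ≡ x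
  transpose-matchʳ x y with y ≟ x
  ... | yes y≡x = y≡x
  ... | no _ rewrite dec-true (y ≟ y) refl = refl

  transpose-fixes : {x y b : Fin n} → x ≢ b → y ≢ b → PC.transpose x y b ≡ b
  transpose-fixes {x} {y} {b} x≢b y≢b
    rewrite dec-false (b ≟ x) (≢-sym x≢b) | dec-false (b ≟ y) (≢-sym y≢b) = refl

  transpose-comm : (x y : Fin n) → PC.transpose x y ≗ PC.transpose y x
  transpose-comm x y e = by-cases (e ≟ x) (e ≟ y)
    where
      by-cases : Dec (e ≡ x) → Dec (e ≡ y) → PC.transpose x y e ≡ PC.transpose y x e
      by-cases (yes e≡x) _ rewrite e≡x = trans (transpose-matchˡ x y) (sym (transpose-matchʳ y x))
      by-cases (no _) (yes e≡y) rewrite e≡y = trans (transpose-matchʳ x y) (sym (transpose-matchˡ y x))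
      by-cases (no e≢x) (no e≢y) = trans (transpose-fixes (≢-sym e≢x) (≢-sym e≢y))
                                         (sym (transpose-fixes (≢-sym e≢y) (≢-sym e≢x)))

  transpose-fixesAll : {x y : Fin n} {B : List (Fin n)} → All (x ≢_) B → All (y ≢_) B →
    All (λ b → PC.transpose x y b ≡ b) B
  transpose-fixesAll x∉B y∉B = All.zipWith (λ (x≢b , y≢b) → transpose-fixes x≢b y≢b) (x∉B , y∉B)

  inversionParity-transposeHead : ∀ A {x y : Fin n} {l} → x ≢ y → Unique (x ∷ l) → y ∈ l →
    inversionParity (A ++ map (PC.transpose x y) (x ∷ l)) ≡ not (inversionParity (A ++ x ∷ l))
  inversionParity-transposeHead A {x} {y} x≢y (x∉l ∷ l!) y∈l
    with B , C , refl , y∉B , y∉C ← unique-split l! y∈l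
    with x∉B , _ ∷ x∉C ← Allₚ.++⁻ B x∉l = begin
    par (A ++ T x ∷ map T (B ++ y ∷ C))
      ≡⟨ cong (λ l′ → par (A ++ T x ∷ l′)) (map-fixing B C (transpose-fixesAll x∉B y∉B)
                                                             (transpose-fixesAll x∉C y∉C)) ⟩
    par (A ++ T x ∷ B ++ T y ∷ C)
      ≡⟨ cong₂ (λ u v → par (A ++ u ∷ B ++ v ∷ C)) (transpose-matchˡ x y) (transpose-matchʳ x y) ⟩
    par (A ++ y ∷ B ++ x ∷ C)
      ≡⟨ inversionParity-swap A B C (≢-sym x≢y) y∉B x∉B ⟩
    not (par (A ++ x ∷ B ++ y ∷ C)) ∎
    where
      open ≡-Reasoning
      par = inversionParity
      T = PC.transpose x y

  inversionParity-transpose : ∀ A {x y : Fin n} {l} → x ≢ y → Unique l → x ∈ l → y ∈ l →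
    inversionParity (A ++ map (PC.transpose x y) l) ≡ not (inversionParity (A ++ l))
  inversionParity-transpose A x≢y _ (here refl) (here refl) = ⊥-elim (x≢y refl)
  inversionParity-transpose A x≢y l! (here refl) (there y∈l) =
    inversionParity-transposeHead A x≢y l! y∈l
  inversionParity-transpose A {x} {y} x≢y l! (there x∈l) (here refl) =
    trans (cong (λ l′ → inversionParity (A ++ l′)) (map-cong (transpose-comm x y) (y ∷ _)))
          (inversionParity-transposeHead A (≢-sym x≢y) l! x∈l)
  inversionParity-transpose A {x} {y} {z ∷ l} x≢y (z∉l ∷ l!) (there x∈l) (there y∈l) = begin
    par (A ++ T z ∷ map T l)
      ≡⟨ cong (λ u → par (A ++ u ∷ map T l)) (transpose-fixes x≢z y≢z) ⟩
    par (A ++ z ∷ map T l)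
      ≡⟨ cong par (++-assoc A (z ∷ []) (map T l)) ⟨
    par ((A ++ z ∷ []) ++ map T l)
      ≡⟨ inversionParity-transpose (A ++ z ∷ []) x≢y l! x∈l y∈l ⟩
    not (par ((A ++ z ∷ []) ++ l))
      ≡⟨ cong (not ∘ par) (++-assoc A (z ∷ []) l) ⟩
    not (par (A ++ z ∷ l)) ∎
    where
      open ≡-Reasoning
      par = inversionParity
      T = PC.transpose x y
      x≢z = ≢-sym (All.lookup z∉l x∈l)
      y≢z = ≢-sym (All.lookup z∉l y∈l)

module _ {n : ℕ} where

  Arrangement : List (Fin n) → Set
  Arrangement l = Unique l × (∀ e → e ∈ l)

  allFin-arrangement : Arrangement (allFin n)
  allFin-arrangement = Unique.allFin⁺ n , ∈-allFin

  record ShiftsParity (b : Bool) (g : Fin n → Fin n) : Set where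
    constructor shiftsParity
    field
      act : ∀ {l} → Arrangement l → Arrangement (map g l) × inversionParity (map g l) ≡ b xor inversionParity l
  open ShiftsParity

  id-shiftsParity : ShiftsParity false id
  id-shiftsParity = shiftsParity λ {l} arr → subst Arrangement (sym (map-id l)) arr , cong inversionParity (map-id l)

  ∘-shiftsParity : ∀ {b c g h} → ShiftsParity b g → ShiftsParity c h → ShiftsParity (b xor c) (g ∘ h)
  ∘-shiftsParity {b} {c} {g} {h} g-shifts h-shifts = shiftsParity λ {l} arr →
    let arr′ , p = act h-shifts arr
        arr″ , q = act g-shifts arr′
    in subst Arrangement (sym (map-∘ l)) arr″ ,
       (begin
         inversionParity (map (g ∘ h) l)    ≡⟨ cong inversionParity (map-∘ l) ⟩
         inversionParity (map g (map h l))  ≡⟨ q ⟩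
         b xor inversionParity (map h l)    ≡⟨ cong (b xor_) p ⟩
         b xor (c xor inversionParity l)    ≡⟨ xor-assoc b c (inversionParity l) ⟨
         (b xor c) xor inversionParity l    ∎)
    where open ≡-Reasoning

  shiftsParity-resp-≗ : ∀ {b g h} → g ≗ h → ShiftsParity b g → ShiftsParity b h
  shiftsParity-resp-≗ {b} g≗h g-shifts = shiftsParity λ {l} arr →
    subst (λ l′ → Arrangement l′ × inversionParity l′ ≡ b xor inversionParity l) (map-cong g≗h l) (act g-shifts arr)

  even-not-odd : ∀ {g} → ShiftsParity false g → ¬ ShiftsParity true g
  even-not-odd g-even g-odd
    with _ , p ← act g-even allFin-arrangement
    with _ , q ← act g-odd allFin-arrangement = not-¬ refl (trans (sym p) q)

  transpose-arrangement : ∀ (x y : Fin n) {l} → Arrangement l → Arrangement (map (PC.transpose x y) l)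
  transpose-arrangement x y {l} (l! , l-covers) = Unique.map⁺ T-injective l! , covers
    where
      T-injective : ∀ {a b} → PC.transpose x y a ≡ PC.transpose x y b → a ≡ b
      T-injective eq =
        trans (sym (PC.transpose-inverse y x)) (trans (cong (PC.transpose y x) eq) (PC.transpose-inverse y x))
      covers : ∀ e → e ∈ map (PC.transpose x y) l
      covers e = subst (_∈ map (PC.transpose x y) l) (PC.transpose-inverse x y)
                       (∈-map⁺ (PC.transpose x y) (l-covers (PC.transpose y x e)))

  transpose-shiftsParity : ∀ {x y : Fin n} → x ≢ y → ShiftsParity true (PC.transpose x y)
  transpose-shiftsParity {x} {y} x≢y = shiftsParity λ arr@(l! , l-covers) →
    transpose-arrangement x y arr , inversionParity-transpose [] x≢y l! (l-covers x) (l-covers y)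

module _ {n : ℕ} where

  rotGo-step : ∀ (f c y : Fin n) xs {e} → e ≢ c → rotGo f c (y ∷ xs) e ≡ rotGo f y xs e
  rotGo-step f c y xs {e} e≢c with e ≟ c
  ... | yes e≡c = ⊥-elim (e≢c e≡c)
  ... | no _    = refl

  rotGo-fresh : ∀ (f c : Fin n) {xs e} → e ≢ c → All (e ≢_) xs → rotGo f c xs e ≡ e
  rotGo-fresh f c {[]} {e} e≢c [] with e ≟ c
  ... | yes e≡c = ⊥-elim (e≢c e≡c)
  ... | no _    = refl
  rotGo-fresh f c {y ∷ xs} e≢c (e≢y ∷ e∉xs) = trans (rotGo-step f c y xs e≢c) (rotGo-fresh f y e≢y e∉xs)

  rotGo-last : ∀ (f c : Fin n) → rotGo f c [] c ≡ f
  rotGo-last f c with c ≟ c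
  ... | yes _  = refl
  ... | no c≢c = ⊥-elim (c≢c refl)

  rotGo-hit : ∀ (f c y : Fin n) xs → rotGo f c (y ∷ xs) c ≡ y
  rotGo-hit f c y xs with c ≟ c
  ... | yes _  = refl
  ... | no c≢c = ⊥-elim (c≢c refl)

  rotGo-current : ∀ (f c c′ : Fin n) xs → rotGo f c xs c ≡ rotGo f c′ xs c′
  rotGo-current f c c′ []       = trans (rotGo-last f c) (sym (rotGo-last f c′))
  rotGo-current f c c′ (y ∷ xs) = trans (rotGo-hit f c y xs) (sym (rotGo-hit f c′ y xs))

  rotGo-current-irrelevant : ∀ (f c c′ : Fin n) xs {e} → e ≢ c → e ≢ c′ → rotGo f c xs e ≡ rotGo f c′ xs e
  rotGo-current-irrelevant f c c′ []       e≢c e≢c′ = trans (rotGo-fresh f c e≢c []) (sym (rotGo-fresh f c′ e≢c′ []))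
  rotGo-current-irrelevant f c c′ (y ∷ xs) e≢c e≢c′ = trans (rotGo-step f c y xs e≢c) (sym (rotGo-step f c′ y xs e≢c′))

  rotate-singleton : (x : Fin n) → rotate (x ∷ []) ≗ id
  rotate-singleton x e with e ≟ x
  ... | yes e≡x = sym e≡x
  ... | no _    = refl

  rotate-∷-∷ : ∀ (x y : Fin n) xs → Unique (x ∷ y ∷ xs) →
    rotate (x ∷ y ∷ xs) ≗ rotate (x ∷ xs) ∘ PC.transpose x y
  rotate-∷-∷ x y xs ((x≢y ∷ _) ∷ (y∉xs ∷ _)) e = by-cases (e ≟ x) (e ≟ y)
    where
      by-cases : Dec (e ≡ x) → Dec (e ≡ y) → rotate (x ∷ y ∷ xs) e ≡ rotate (x ∷ xs) (PC.transpose x y e)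
      by-cases (yes refl) _ = begin
        rotGo x x (y ∷ xs) x             ≡⟨ rotGo-hit x x y xs ⟩
        y                                ≡⟨ rotGo-fresh x x (≢-sym x≢y) y∉xs ⟨
        rotGo x x xs y                   ≡⟨ cong (rotGo x x xs) (transpose-matchˡ x y) ⟨
        rotGo x x xs (PC.transpose x y x) ∎
        where open ≡-Reasoning
      by-cases (no e≢x) (yes refl) = begin
        rotGo x x (y ∷ xs) y             ≡⟨ rotGo-step x x y xs e≢x ⟩
        rotGo x y xs y                   ≡⟨ rotGo-current x y x xs ⟩
        rotGo x x xs x                   ≡⟨ cong (rotGo x x xs) (transpose-matchʳ x y) ⟨
        rotGo x x xs (PC.transpose x y y) ∎
        where open ≡-Reasoning
      by-cases (no e≢x) (no e≢y) = begin
        rotGo x x (y ∷ xs) e             ≡⟨ rotGo-step x x y xs e≢x ⟩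
        rotGo x y xs e                   ≡⟨ rotGo-current-irrelevant x y x xs e≢y e≢x ⟩
        rotGo x x xs e                   ≡⟨ cong (rotGo x x xs) (transpose-fixes (≢-sym e≢x) (≢-sym e≢y)) ⟨
        rotGo x x xs (PC.transpose x y e) ∎
        where open ≡-Reasoning

  rotate-even : ∀ {c : List (Fin n)} → Unique c → Odd (length c) → ShiftsParity false (rotate c)
  rotate-even {x ∷ []} _ _ = shiftsParity-resp-≗ (sym ∘ rotate-singleton x) id-shiftsParity
  -- The recursive call type-checks since Odd (3 + k) and Odd (1 + k) are the same type.
  rotate-even {x ∷ y ∷ z ∷ xs} c!@((x≢y ∷ x≢z ∷ x∉xs) ∷ (_ ∷ z∉xs ∷ xs!)) odd =
    shiftsParity-resp-≗ (sym ∘ decomposition)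
      (∘-shiftsParity (rotate-even (x∉xs ∷ xs!) odd)
                      (∘-shiftsParity (transpose-shiftsParity x≢z) (transpose-shiftsParity x≢y)))
    where
      decomposition : rotate (x ∷ y ∷ z ∷ xs) ≗ rotate (x ∷ xs) ∘ PC.transpose x z ∘ PC.transpose x y
      decomposition e =
        trans (rotate-∷-∷ x y (z ∷ xs) c! e)
              (rotate-∷-∷ x z xs ((x≢z ∷ x∉xs) ∷ (z∉xs ∷ xs!)) (PC.transpose x y e))

OddSimpleCycles : Shape → Set
OddSimpleCycles S = ∀ c → c ∈ cycles S → Unique c × Odd (length c)

generated-even : ∀ {S f} → OddSimpleCycles S → Generated S f → ShiftsParity false f
generated-even cycles-odd gid = id-shiftsParity
generated-even cycles-odd (gmul c c∈ g) with c! , odd ← cycles-odd c c∈ =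
  ∘-shiftsParity (rotate-even c! odd) (generated-even cycles-odd g)
generated-even cycles-odd (ginv c c∈ g) with c! , odd ← cycles-odd c c∈ =
  ∘-shiftsParity (rotate-even (unique-reverse c!) (subst Odd (sym (length-reverse c)) odd))
                 (generated-even cycles-odd g)

two-distinct : ∀ {n} → 2 ≤ n → ∃₂ λ (x y : Fin n) → x ≢ y
two-distinct (s≤s (s≤s _)) = zero , suc zero , λ ()

oddSimpleCycles⇒¬complete : ∀ {S} → OddSimpleCycles S → 2 ≤ nE S → ¬ Complete S
oddSimpleCycles⇒¬complete cycles-odd 2≤nE complete
  with x , y , x≢y ← two-distinct 2≤nE
  with f , g , f≗transpose ← complete (transpose x y) =
  even-not-odd (generated-even cycles-odd g)
               (shiftsParity-resp-≗ (sym ∘ f≗transpose) (transpose-shiftsParity x≢y))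

module _ {S : Shape} where

  joins-endpoint : ∀ {e a c u w} → Joins S e a c → Joins S e u w → a ≡ u ⊎ a ≡ w
  joins-endpoint (inj₁ p) (inj₁ q) = inj₁ (cong proj₁ (trans (sym p) q))
  joins-endpoint (inj₁ p) (inj₂ q) = inj₂ (cong proj₁ (trans (sym p) q))
  joins-endpoint (inj₂ p) (inj₁ q) = inj₂ (cong proj₂ (trans (sym p) q))
  joins-endpoint (inj₂ p) (inj₂ q) = inj₁ (cong proj₂ (trans (sym p) q))

  walk-start∈ : ∀ {a b es vs} → Walk S a b es vs → a ∈ vs
  walk-start∈ here       = here refl
  walk-start∈ (step _ _) = here refl

  walk-endpoint∈ : ∀ {a b es vs e u w} → Walk S a b es vs → e ∈ es → Joins S e u w → u ∈ vs
  walk-endpoint∈ (step j w) (here refl) j′ with joins-endpoint j′ j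
  ... | inj₁ refl = here refl
  ... | inj₂ refl = there (walk-start∈ w)
  walk-endpoint∈ (step j w) (there e∈es) j′ = there (walk-endpoint∈ w e∈es j′)

  walk-edges-unique : ∀ {a b es vs} → Walk S a b es vs → Unique vs → Unique es
  walk-edges-unique here _ = []
  walk-edges-unique (step j w) (a∉vs ∷ vs!) =
    Allₚ.¬Any⇒All¬ _ (λ e∈es → Allₚ.All¬⇒¬Any a∉vs (walk-endpoint∈ w e∈es j)) ∷ walk-edges-unique w vs!

↑ˡ≢↑ʳ : ∀ {m n} (i : Fin m) (j : Fin n) → i ↑ˡ n ≢ m ↑ʳ j
↑ˡ≢↑ʳ {m} {n} i j eq with () ← trans (sym (splitAt-↑ˡ m i n)) (trans (cong (splitAt m) eq) (splitAt-↑ʳ m n j))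

rubiks-cycles-unique : ∀ {S} → IsRubiksShape S → ∀ c → c ∈ cycles S → Unique c
rubiks-cycles-unique (base m _) c (here refl) = Unique.allFin⁺ m
rubiks-cycles-unique (add {S} shape _ _ es path _ k′) c c∈
  with ∈-++⁻ (map (map (_↑ˡ suc (suc k′))) (cycles S)) c∈
... | inj₁ c∈old with c′ , c′∈ , refl ← ∈-map⁻ (map (_↑ˡ suc (suc k′))) c∈old =
  Unique.map⁺ (↑ˡ-injective _ _ _) (rubiks-cycles-unique shape c′ c′∈)
... | inj₂ (here refl) = Unique.++⁺ old-edges! (unique-reverse {xs = new-edges} new-edges!) disjoint
  where
    old-edges new-edges : List (Fin (nE S + suc (suc k′)))
    old-edges = map (_↑ˡ suc (suc k′)) es
    new-edges = map (nE S ↑ʳ_) (allFin (suc (suc k′)))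
    old-edges! : Unique old-edges
    old-edges! = Unique.map⁺ (↑ˡ-injective _ _ _) (walk-edges-unique (IsPath.walk path) (IsPath.distinct path))
    new-edges! : Unique new-edges
    new-edges! = Unique.map⁺ (↑ʳ-injective _ _ _) (Unique.allFin⁺ (suc (suc k′)))
    disjoint : ∀ {v} → ¬ (v ∈ old-edges × v ∈ reverse new-edges)
    disjoint (v∈old , v∈new)
      with f , _ , refl ← ∈-map⁻ (_↑ˡ suc (suc k′)) v∈old
      with j , _ , eq ← ∈-map⁻ (nE S ↑ʳ_) (Anyₚ.reverse⁻ {xs = new-edges} v∈new) = ↑ˡ≢↑ʳ f j eq

rubiks-2≤nE : ∀ {S} → IsRubiksShape S → 2 ≤ nE S
rubiks-2≤nE (base _ (s≤s (s≤s _))) = s≤s (s≤s z≤n)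
rubiks-2≤nE (add {S} _ _ _ _ _ _ k′) = ≤-trans (s≤s (s≤s z≤n)) (m≤n+m (suc (suc k′)) (nE S))

mainTheorem3 : (S : Shape) → IsRubiksShape S →
    (C₁ C₂ : List _) → cycles S ≡ C₁ ∷ C₂ ∷ [] →
    Odd (length C₁) → Odd (length C₂) →
    ¬ Complete S
mainTheorem3 S shape C₁ C₂ cycles≡ odd₁ odd₂ =
  oddSimpleCycles⇒¬complete cycles-odd (rubiks-2≤nE shape)
  where
    odd : ∀ {c} → c ∈ C₁ ∷ C₂ ∷ [] → Odd (length c)
    odd (here refl)         = odd₁
    odd (there (here refl)) = odd₂
    cycles-odd : OddSimpleCycles S
    cycles-odd c c∈ = rubiks-cycles-unique shape c c∈ , odd (subst (c ∈_) cycles≡ c∈)
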